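{- Let $M$ be a binary matroid of rank $r$ on ground set $S$. Every rainbow circuit-free coloring of $M$ with exactly $r$ colors is standard. In particular, one of the color classes consists of pairwise parallel elements.
   Context: A matroid is binary if it is representable over $GF(2)$. A coloring of $S$ with color classes $S_1,\dots,S_k$ (a partition of $S$ into nonempty sets) is rainbow circuit-free if no circuit of $M$ is rainbow colored, i.e. every circuit contains two elements of the same color. A cut of a matroid is an inclusionwise minimal subset of the ground set meeting every basis. For a matroid $M$ of rank $r$, a coloring of $S$ with exactly $r$ color classes is standard if the color classes can be indexed as $S_1,\dots,S_r$ so that for every $i=1,\dots,r$, $S_i$ is a cut of the restriction $M|(S_1\cup\dots\cup S_i)$. Two non-loop elements $e,f$ are parallel if $r_M(\{e,f\})=1$. -}

module Defs where

open import Data.Nat using (ℕ; zero; suc; _≤_; _<_)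
open import Data.Bool using (Bool; true; false; if_then_else_; _xor_)
open import Data.Fin using (Fin) renaming (zero to fzero; suc to fsuc)
import Data.Fin as F
open import Data.Fin.Subset using (Subset; _⊆_; _∈_; _∩_; _∪_; ⁅_⁆; ⊤; ⋃; Nonempty; ∣_∣)
open import Data.Fin.Permutation using (Permutation′; _⟨$⟩ʳ_)
open import Data.Vec using (Vec; []; _∷_; tabulate)
open import Data.List using (List; map; filter)
open import Data.Product using (Σ; ∃; ∃₂; _×_)
open import Relation.Nullary using (¬_; does)
open import Relation.Binary.PropositionalEquality using (_≡_; _≢_)

-- A binary matroid on ground set Fin n is given by a GF(2)-representation:
-- a family of column vectors v e ∈ GF(2)^m (Bool with xor as addition).
Rep : ℕ → ℕ → Set
Rep m n = Fin n → Fin m → Bool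

zeroVec : ∀ {m} → Fin m → Bool
zeroVec _ = false

sumOver : ∀ {m n} → Rep m n → Subset n → Fin m → Bool
sumOver {n = zero}  v []      k = false
sumOver {n = suc n} v (b ∷ X) k =
  if b then v fzero k xor sumOver (λ e → v (fsuc e)) X k
       else sumOver (λ e → v (fsuc e)) X k

Indep : ∀ {m n} → Rep m n → Subset n → Set
Indep v X = ∀ Y → Y ⊆ X → (∀ k → sumOver v Y k ≡ false) → ¬ Nonempty Y

_⊂_ : ∀ {n} → Subset n → Subset n → Set
Y ⊂ X = Y ⊆ X × ¬ (X ⊆ Y)

Circuit : ∀ {m n} → Rep m n → Subset n → Set
Circuit v C = ¬ Indep v C × (∀ D → D ⊂ C → Indep v D)

IsRank : ∀ {m n} → Rep m n → Subset n → ℕ → Set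
IsRank v T k =
  (Σ _ λ I → I ⊆ T × Indep v I × ∣ I ∣ ≡ k) ×
  (∀ I → I ⊆ T → Indep v I → ∣ I ∣ ≤ k)

BasisOf : ∀ {m n} → Rep m n → Subset n → Subset n → Set
BasisOf v T B = B ⊆ T × Indep v B × (∀ I → I ⊆ T → Indep v I → B ⊆ I → I ⊆ B)

MeetsAllBases : ∀ {m n} → Rep m n → Subset n → Subset n → Set
MeetsAllBases v T X = ∀ B → BasisOf v T B → Nonempty (X ∩ B)

CutOf : ∀ {m n} → Rep m n → Subset n → Subset n → Set
CutOf v T C =
  C ⊆ T × MeetsAllBases v T C ×
  (∀ D → D ⊆ C → MeetsAllBases v T D → C ⊆ D)

-- A coloring with exactly k colors: a surjection c : Fin n → Fin k
-- (color classes are the fibres, all nonempty).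
Surj : ∀ {n k} → (Fin n → Fin k) → Set
Surj {n} {k} c = ∀ j → ∃ λ e → c e ≡ j

ColorClass : ∀ {n k} → (Fin n → Fin k) → Fin k → Subset n
ColorClass c j = tabulate (λ e → does (c e F.≟ j))

RainbowCircuitFree : ∀ {m n k} → Rep m n → (Fin n → Fin k) → Set
RainbowCircuitFree v c =
  ∀ C → Circuit v C → ∃₂ λ e f → e ≢ f × e ∈ C × f ∈ C × c e ≡ c f

PrefixUnion : ∀ {n r} → (Fin n → Fin r) → Permutation′ r → Fin r → Subset n
PrefixUnion {r = r} c π i =
  ⋃ (map (λ j → ColorClass c (π ⟨$⟩ʳ j)) (filter (λ j → j F.≤? i) (Data.List.allFin r)))
  where import Data.List

Standard : ∀ {m n r} → Rep m n → (Fin n → Fin r) → Set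
Standard {r = r} v c =
  Σ (Permutation′ r) λ π →
    ∀ i → CutOf v (PrefixUnion c π i) (ColorClass c (π ⟨$⟩ʳ i))

Parallel : ∀ {m n} → Rep m n → Fin n → Fin n → Set
Parallel v e f = IsRank v ⁅ e ⁆ 1 × IsRank v ⁅ f ⁆ 1 × IsRank v (⁅ e ⁆ ∪ ⁅ f ⁆) 1

-- In a rainbow circuit-free colouring every rainbow set is independent, because it contains no
-- circuit. So a set A of representatives a j of the r colours is a basis, and every element e has
-- a coordinate vector over A whose entry at a (c e) is 1. Say that colour k feeds colour j if some
-- element of colour j has a nonzero coordinate at a k. Binarity makes this relation acyclic: in a
-- minimal set R of colours without a sink, the coordinates of suitably chosen elements, one of
-- each colour of R, cancel in pairs inside R, producing a nonempty rainbow set of zero sum.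
-- Listing the colours along the relation makes the coordinate matrix triangular. Then the i-th
-- colour class S is a cut of the restriction to the first i classes: a basis missing S could be
-- enlarged by the representative of S, which is the only element there with a coordinate at it,
-- while every x ∈ S lies in the basis formed by x and the representatives of the earlier colours.
-- The first colour class consists of elements whose only coordinate is its representative,
-- hence of pairwise parallel elements.

module Submission where

open import Defs
open import Algebra.Bundles using (CommutativeRing)
open import Data.Bool using (Bool; true; false; _∧_; _xor_; if_then_else_)
open import Data.Bool.Properties as BP
  using (xor-same; xor-∧-commutativeRing; ∧-distribʳ-xor; ¬-not)
open import Algebra.Properties.CommutativeSemigroup
  (CommutativeRing.+-commutativeSemigroup xor-∧-commutativeRing) using (interchange)
open import Data.Empty using (⊥-elim)
open import Data.Fin as F using (Fin; _≟_) renaming (zero to fzero; suc to fsuc)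
open import Data.Fin.Properties as FP using (any?; all?)
open import Data.Fin.Subset
  using (Subset; _∈_; _∉_; _⊆_; ⊤; ⊥; ⁅_⁆; _∪_; _∩_; _-_; ⋃; Nonempty; ∣_∣)
  renaming (_⊂_ to _⊊_)
open import Data.Fin.Subset.Properties as SP
  using (_∈?_; _⊆?_; _⊂?_; nonempty?; anySubset?; ⊆-refl; ⊆-trans; p⊂q⇒p⊆q
        ; x∈p∪q⁻; p⊆p∪q; q⊆p∪q; x∈⁅x⁆; x∈⁅y⁆⇒x≡y; x≢y⇒x∉⁅y⁆; x∈p⇒∣p-x∣<∣p∣
        ; x∈p∧x≢y⇒x∈p-y; x∈p⇒p-x⊂p; ∈⊤)
open import Data.Fin.Subset.Induction using (Acc; acc; ⊂-wellFounded)
open import Data.List as L using (List; []; _∷_)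
import Data.List.Membership.Propositional as List
import Data.List.Membership.Propositional.Properties as ListP
import Data.List.Relation.Unary.Any as Any
open import Data.Nat using (ℕ; zero; suc; _≤_; _<_; z≤n; s≤s)
open import Data.Nat.Properties as NP using (≤-trans)
open import Data.Product using (∃; ∃₂; _×_; _,_; proj₁; proj₂)
open import Data.Sum using (_⊎_; inj₁; inj₂)
open import Data.Vec using ([]; _∷_; here; there; lookup; tabulate; zipWith; replicate)
open import Data.Vec.Properties using (lookup-zipWith; lookup-replicate; lookup∘tabulate; []=⇒lookup; lookup⇒[]=)
open import Function.Definitions using (Injective)
open import Data.Fin.Permutation using (Permutation′; permutation)
open import Relation.Nullary using (¬_; Dec; yes; no; does)
open import Relation.Nullary.Decidable using (_×-dec_; ¬?; dec-true)
open import Relation.Binary.PropositionalEquality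
open import Relation.Binary.Definitions using (tri<; tri≈; tri>)

private
  variable
    m n d : ℕ

∈⇒lookup : ∀ {X : Subset n} {x} → x ∈ X → lookup X x ≡ true
∈⇒lookup = []=⇒lookup

lookup⇒∈ : ∀ {X : Subset n} {x} → lookup X x ≡ true → x ∈ X
lookup⇒∈ {X = X} {x} = lookup⇒[]= x X

∉⇒lookup : ∀ {X : Subset n} {x} → x ∉ X → lookup X x ≡ false
∉⇒lookup x∉X = ¬-not (λ eq → x∉X (lookup⇒∈ eq))

lookup-false⇒∉ : ∀ {X : Subset n} {x} → lookup X x ≡ false → x ∉ X
lookup-false⇒∉ lookup≡false x∈X = BP.not-¬ (∈⇒lookup x∈X) lookup≡false

lookup-⊥ : ∀ (x : Fin n) → lookup ⊥ x ≡ false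
lookup-⊥ x = lookup-replicate x false

does-true⇒ : ∀ {A : Set} (A? : Dec A) → does A? ≡ true → A
does-true⇒ (yes a) _ = a

∈-tabulate⁺ : ∀ {P : Fin n → Set} (P? : ∀ x → Dec (P x)) {x} → P x → x ∈ tabulate (λ y → does (P? y))
∈-tabulate⁺ P? {x} px = lookup⇒∈ (trans (lookup∘tabulate _ x) (dec-true (P? x) px))

∈-tabulate⁻ : ∀ {P : Fin n → Set} (P? : ∀ x → Dec (P x)) {x} → x ∈ tabulate (λ y → does (P? y)) → P x
∈-tabulate⁻ P? {x} x∈ = does-true⇒ (P? x) (trans (sym (lookup∘tabulate _ x)) (∈⇒lookup x∈))

infixl 6 _⊕_

_⊕_ : Subset n → Subset n → Subset n
_⊕_ = zipWith _xor_

lookup-⊕ : ∀ (X Y : Subset n) x → lookup (X ⊕ Y) x ≡ lookup X x xor lookup Y x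
lookup-⊕ X Y x = lookup-zipWith _xor_ x X Y

∈-⋃⁻ : ∀ (Ps : List (Subset n)) {x} → x ∈ ⋃ Ps → ∃ λ P → P List.∈ Ps × x ∈ P
∈-⋃⁻ [] x∈ = ⊥-elim (SP.∉⊥ x∈)
∈-⋃⁻ (P ∷ Ps) x∈ with x∈p∪q⁻ P (⋃ Ps) x∈
... | inj₁ x∈P = P , Any.here refl , x∈P
... | inj₂ x∈⋃ with ∈-⋃⁻ Ps x∈⋃
...   | Q , Q∈Ps , x∈Q = Q , Any.there Q∈Ps , x∈Q

∈-⋃⁺ : ∀ {Ps : List (Subset n)} {P x} → P List.∈ Ps → x ∈ P → x ∈ ⋃ Ps
∈-⋃⁺ {Ps = Q ∷ Ps} (Any.here refl) x∈P = p⊆p∪q (⋃ Ps) x∈P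
∈-⋃⁺ {Ps = Q ∷ Ps} (Any.there P∈Ps) x∈P = q⊆p∪q Q (⋃ Ps) (∈-⋃⁺ P∈Ps x∈P)

∈-⊕⁻ : ∀ (X Y : Subset n) {x} → x ∈ X ⊕ Y → (x ∈ X × x ∉ Y) ⊎ (x ∉ X × x ∈ Y)
∈-⊕⁻ X Y {x} x∈ = split (lookup X x) (lookup Y x) refl refl (trans (sym (lookup-⊕ X Y x)) (∈⇒lookup x∈))
  where
  split : ∀ b b′ → lookup X x ≡ b → lookup Y x ≡ b′ → b xor b′ ≡ true → (x ∈ X × x ∉ Y) ⊎ (x ∉ X × x ∈ Y)
  split true false x∈X x∉Y _ = inj₁ (lookup⇒∈ x∈X , lookup-false⇒∉ x∉Y)
  split false true x∉X x∈Y _ = inj₂ (lookup-false⇒∉ x∉X , lookup⇒∈ x∈Y)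

∈-⊕⁺ : ∀ (X Y : Subset n) {x} → (x ∈ X × x ∉ Y) ⊎ (x ∉ X × x ∈ Y) → x ∈ X ⊕ Y
∈-⊕⁺ X Y {x} only = lookup⇒∈ (trans (lookup-⊕ X Y x) (xor-true only))
  where
  xor-true : (x ∈ X × x ∉ Y) ⊎ (x ∉ X × x ∈ Y) → lookup X x xor lookup Y x ≡ true
  xor-true (inj₁ (x∈X , x∉Y)) = cong₂ _xor_ (∈⇒lookup x∈X) (∉⇒lookup x∉Y)
  xor-true (inj₂ (x∉X , x∈Y)) = cong₂ _xor_ (∉⇒lookup x∉X) (∈⇒lookup x∈Y)

⊕⊆∪ : ∀ (X Y : Subset n) → X ⊕ Y ⊆ X ∪ Y
⊕⊆∪ X Y x∈ with ∈-⊕⁻ X Y x∈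
... | inj₁ (x∈X , _) = p⊆p∪q Y x∈X
... | inj₂ (_ , x∈Y) = q⊆p∪q X Y x∈Y

x∉p-x : ∀ (P : Subset n) x → x ∉ P - x
x∉p-x (b ∷ P) fzero ()
x∉p-x (b ∷ P) (fsuc x) (there x∈) = x∉p-x P x x∈

x∈p-y⁻ : ∀ {P : Subset n} {x y} → x ∈ P - y → x ∈ P × x ≢ y
x∈p-y⁻ {P = P} {y = y} x∈ = SP.p─q⊆p P ⁅ y ⁆ x∈ , λ { refl → x∉p-x P y x∈ }

x∈p∪⁅y⁆⇒x∈p : ∀ {P : Subset n} {x y} → x ∈ P ∪ ⁅ y ⁆ → x ≢ y → x ∈ P
x∈p∪⁅y⁆⇒x∈p {P = P} {y = y} x∈ x≢y with x∈p∪q⁻ P ⁅ y ⁆ x∈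
... | inj₁ x∈P = x∈P
... | inj₂ x∈y = ⊥-elim (x≢y (x∈⁅y⁆⇒x≡y y x∈y))

scaled-⊆ : ∀ b (X : Subset n) → (if b then X else ⊥) ⊆ X
scaled-⊆ true X x∈ = x∈
scaled-⊆ false X x∈ = ⊥-elim (SP.∉⊥ x∈)

lookup-cong : ∀ {X Y : Subset n} {x} → (x ∈ X → x ∈ Y) → (x ∈ Y → x ∈ X) → lookup X x ≡ lookup Y x
lookup-cong {X = X} {Y} {x} to from with lookup X x in lx | lookup Y x in ly
... | true | true = refl
... | false | false = refl
... | true | false = ⊥-elim (lookup-false⇒∉ ly (to (lookup⇒∈ lx)))
... | false | true = ⊥-elim (lookup-false⇒∉ lx (from (lookup⇒∈ ly)))

¬⊆⇒∃∉ : ∀ {X Y : Subset n} → ¬ (X ⊆ Y) → ∃ λ x → x ∈ X × x ∉ Y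
¬⊆⇒∃∉ {X = X} {Y} X⊈Y with any? (λ x → (x ∈? X) ×-dec ¬? (x ∈? Y))
... | yes witness = witness
... | no none = ⊥-elim (X⊈Y X⊆Y)
  where
  X⊆Y : X ⊆ Y
  X⊆Y {x} x∈X with x ∈? Y
  ... | yes x∈Y = x∈Y
  ... | no x∉Y = ⊥-elim (none (x , x∈X , x∉Y))

ZeroSum : Rep m n → Subset n → Set
ZeroSum v X = ∀ k → sumOver v X k ≡ false

zeroSum? : (v : Rep m n) → ∀ X → Dec (ZeroSum v X)
zeroSum? v X = all? (λ k → sumOver v X k BP.≟ false)

sumOver-∷ : ∀ (v : Rep m (suc n)) b X k →
  sumOver v (b ∷ X) k ≡ (b ∧ v fzero k) xor sumOver (λ e → v (fsuc e)) X k
sumOver-∷ v true X k = refl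
sumOver-∷ v false X k = refl

sumOver-⊥ : ∀ (v : Rep m n) k → sumOver v ⊥ k ≡ false
sumOver-⊥ {n = zero} v k = refl
sumOver-⊥ {n = suc n} v k = sumOver-⊥ (λ e → v (fsuc e)) k

sumOver-⁅⁆ : ∀ (v : Rep m n) e k → sumOver v ⁅ e ⁆ k ≡ v e k
sumOver-⁅⁆ v fzero k = trans (cong (v fzero k xor_) (sumOver-⊥ (λ e → v (fsuc e)) k)) (BP.xor-identityʳ _)
sumOver-⁅⁆ v (fsuc e) k = sumOver-⁅⁆ (λ e → v (fsuc e)) e k

sumOver-⊕ : ∀ (v : Rep m n) X Y k → sumOver v (X ⊕ Y) k ≡ sumOver v X k xor sumOver v Y k
sumOver-⊕ v [] [] k = refl
sumOver-⊕ v (b ∷ X) (b′ ∷ Y) k = begin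
  sumOver v ((b xor b′) ∷ (X ⊕ Y)) k
    ≡⟨ sumOver-∷ v (b xor b′) (X ⊕ Y) k ⟩
  ((b xor b′) ∧ x) xor sumOver v′ (X ⊕ Y) k
    ≡⟨ cong₂ _xor_ (∧-distribʳ-xor x b b′) (sumOver-⊕ v′ X Y k) ⟩
  ((b ∧ x) xor (b′ ∧ x)) xor (sumOver v′ X k xor sumOver v′ Y k)
    ≡⟨ interchange (b ∧ x) (b′ ∧ x) _ _ ⟩
  ((b ∧ x) xor sumOver v′ X k) xor ((b′ ∧ x) xor sumOver v′ Y k)
    ≡⟨ sym (cong₂ _xor_ (sumOver-∷ v b X k) (sumOver-∷ v b′ Y k)) ⟩
  sumOver v (b ∷ X) k xor sumOver v (b′ ∷ Y) k ∎
  where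
  open ≡-Reasoning
  x = v fzero k
  v′ = λ e → v (fsuc e)

sumOver-cong : ∀ (v : Rep m n) {X Y} k →
  (∀ e → v e k ≡ true → lookup X e ≡ lookup Y e) → sumOver v X k ≡ sumOver v Y k
sumOver-cong v {[]} {[]} k agree = refl
sumOver-cong v {b ∷ X} {b′ ∷ Y} k agree
  rewrite sumOver-∷ v b X k | sumOver-∷ v b′ Y k
        | sumOver-cong (λ e → v (fsuc e)) {X} {Y} k (λ e → agree (fsuc e))
  with v fzero k in vₖ
... | true = cong (λ b → (b ∧ true) xor _) (agree fzero vₖ)
... | false = trans (cong (_xor _) (BP.∧-zeroʳ b)) (cong (_xor _) (sym (BP.∧-zeroʳ b′)))

sumOver-vanishes : ∀ (v : Rep m n) X k → (∀ e → e ∈ X → v e k ≡ false) → sumOver v X k ≡ false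
sumOver-vanishes v X k vanish = trans (sumOver-cong v k outside) (sumOver-⊥ v k)
  where
  outside : ∀ e → v e k ≡ true → lookup X e ≡ lookup ⊥ e
  outside e vₑ = trans (∉⇒lookup (λ e∈X → BP.not-¬ vₑ (vanish e e∈X))) (sym (lookup-⊥ e))

sumOver-scaled : ∀ (v : Rep m n) b X k → sumOver v (if b then X else ⊥) k ≡ (b ∧ sumOver v X k)
sumOver-scaled v true X k = refl
sumOver-scaled v false X k = sumOver-⊥ v k

symDiffOver : (Fin n → Subset d) → Subset n → Subset d
symDiffOver T [] = ⊥
symDiffOver T (b ∷ X) = (if b then T fzero else ⊥) ⊕ symDiffOver (λ e → T (fsuc e)) X

lookup-symDiffOver : ∀ (T : Fin n → Subset d) X y →
  lookup (symDiffOver T X) y ≡ sumOver (λ e → lookup (T e)) X y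
lookup-symDiffOver T [] y = lookup-⊥ y
lookup-symDiffOver T (b ∷ X) y = begin
  lookup ((if b then T fzero else ⊥) ⊕ symDiffOver T′ X) y
    ≡⟨ lookup-⊕ (if b then T fzero else ⊥) (symDiffOver T′ X) y ⟩
  lookup (if b then T fzero else ⊥) y xor lookup (symDiffOver T′ X) y
    ≡⟨ cong₂ _xor_ (scaled b) (lookup-symDiffOver T′ X y) ⟩
  (b ∧ lookup (T fzero) y) xor sumOver (λ e → lookup (T′ e)) X y
    ≡⟨ sym (sumOver-∷ (λ e → lookup (T e)) b X y) ⟩
  sumOver (λ e → lookup (T e)) (b ∷ X) y ∎
  where
  open ≡-Reasoning
  T′ = λ e → T (fsuc e)
  scaled : ∀ b → lookup (if b then T fzero else ⊥) y ≡ (b ∧ lookup (T fzero) y)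
  scaled true = refl
  scaled false = lookup-⊥ y

sumOver-symDiffOver : ∀ (v : Rep m n) (w : Rep m d) (T : Fin n → Subset d) →
  (∀ e k → v e k ≡ sumOver w (T e) k) → ∀ X k → sumOver v X k ≡ sumOver w (symDiffOver T X) k
sumOver-symDiffOver v w T v≡ [] k = sym (sumOver-⊥ w k)
sumOver-symDiffOver v w T v≡ (b ∷ X) k = begin
  sumOver v (b ∷ X) k
    ≡⟨ sumOver-∷ v b X k ⟩
  (b ∧ v fzero k) xor sumOver (λ e → v (fsuc e)) X k
    ≡⟨ cong₂ (λ x s → (b ∧ x) xor s) (v≡ fzero k)
             (sumOver-symDiffOver (λ e → v (fsuc e)) w T′ (λ e → v≡ (fsuc e)) X k) ⟩
  (b ∧ sumOver w (T fzero) k) xor sumOver w (symDiffOver T′ X) k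
    ≡⟨ cong (_xor sumOver w (symDiffOver T′ X) k) (sym (sumOver-scaled w b (T fzero) k)) ⟩
  sumOver w (if b then T fzero else ⊥) k xor sumOver w (symDiffOver T′ X) k
    ≡⟨ sym (sumOver-⊕ w (if b then T fzero else ⊥) (symDiffOver T′ X) k) ⟩
  sumOver w (symDiffOver T (b ∷ X)) k ∎
  where
  open ≡-Reasoning
  T′ = λ e → T (fsuc e)

injective⇒≤∣∣ : ∀ {t} (g : Fin t → Fin n) → Injective _≡_ _≡_ g → ∀ {X} → (∀ i → g i ∈ X) → t ≤ ∣ X ∣
injective⇒≤∣∣ {t = zero} g g-inj g∈X = z≤n
injective⇒≤∣∣ {t = suc t} g g-inj {X} g∈X = ≤-trans (s≤s rest) (x∈p⇒∣p-x∣<∣p∣ (g∈X fzero))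
  where
  rest : t ≤ ∣ X - g fzero ∣
  rest = injective⇒≤∣∣ (λ i → g (fsuc i)) (λ eq → FP.suc-injective (g-inj eq))
           (λ i → x∈p∧x≢y⇒x∈p-y (g∈X (fsuc i)) (λ eq → FP.0≢1+n (sym (g-inj eq))))

injective⇒surjective : ∀ {k} (f : Fin k → Fin k) → Injective _≡_ _≡_ f → ∀ y → ∃ λ x → f x ≡ y
injective⇒surjective {suc k} f f-inj y with any? (λ x → f x ≟ y)
... | yes hit = hit
... | no miss = ⊥-elim (NP.<-irrefl refl (FP.injective⇒≤ f-punchOut-inj))
  where
  f-punchOut : Fin (suc k) → Fin k
  f-punchOut x = F.punchOut {i = y} {j = f x} (λ eq → miss (x , sym eq))
  f-punchOut-inj : Injective _≡_ _≡_ f-punchOut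
  f-punchOut-inj {x} {x′} eq =
    f-inj (FP.punchOut-injective (λ eq → miss (x , sym eq)) (λ eq → miss (x′ , sym eq)) eq)

dependent⇒⊇circuit : ∀ (v : Rep m n) Y → Nonempty Y → ZeroSum v Y → ∃ λ C → C ⊆ Y × Circuit v C
dependent⇒⊇circuit v Y = go Y (⊂-wellFounded Y)
  where
  smaller? : ∀ Y → Dec (∃ λ W → W ⊊ Y × Nonempty W × ZeroSum v W)
  smaller? Y = anySubset? (λ W → (W ⊂? Y) ×-dec nonempty? W ×-dec zeroSum? v W)

  go : ∀ Y → Acc _⊊_ Y → Nonempty Y → ZeroSum v Y → ∃ λ C → C ⊆ Y × Circuit v C
  go Y (acc smaller) ne zs with smaller? Y
  ... | yes (W , W⊊Y , neW , zsW) with go W (smaller W⊊Y) neW zsW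
  ...   | C , C⊆W , circuit = C , ⊆-trans C⊆W (p⊂q⇒p⊆q W⊊Y) , circuit
  go Y _ ne zs | no none = Y , ⊆-refl , (λ indep → indep Y ⊆-refl zs ne) , minimal
    where
    minimal : ∀ D → D ⊂ Y → Indep v D
    minimal D (D⊆Y , Y⊈D) W W⊆D zsW neW with ¬⊆⇒∃∉ Y⊈D
    ... | x , x∈Y , x∉D = none (W , (⊆-trans W⊆D D⊆Y , x , x∈Y , λ x∈W → x∉D (W⊆D x∈W)) , neW , zsW)

Rainbow : ∀ {k} → (Fin n → Fin k) → Subset n → Set
Rainbow c X = ∀ {e f} → e ∈ X → f ∈ X → c e ≡ c f → e ≡ f

rainbow-⊆ : ∀ {k} {c : Fin n → Fin k} {X Y} → Y ⊆ X → Rainbow c X → Rainbow c Y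
rainbow-⊆ Y⊆X rainbow e∈ f∈ = rainbow (Y⊆X e∈) (Y⊆X f∈)

rainbow-∪ : ∀ {k} {c : Fin n → Fin k} {X Y} → Rainbow c X → Rainbow c Y →
  (∀ {x y} → x ∈ X → y ∈ Y → c x ≢ c y) → Rainbow c (X ∪ Y)
rainbow-∪ {X = X} {Y} rbX rbY apart {e} {f} e∈ f∈ same with x∈p∪q⁻ X Y e∈ | x∈p∪q⁻ X Y f∈
... | inj₁ e∈X | inj₁ f∈X = rbX e∈X f∈X same
... | inj₁ e∈X | inj₂ f∈Y = ⊥-elim (apart e∈X f∈Y same)
... | inj₂ e∈Y | inj₁ f∈X = ⊥-elim (apart f∈X e∈Y (sym same))
... | inj₂ e∈Y | inj₂ f∈Y = rbY e∈Y f∈Y same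

rainbow-⁅⁆ : ∀ {k} {c : Fin n → Fin k} e → Rainbow c ⁅ e ⁆
rainbow-⁅⁆ e e′∈ f′∈ _ = trans (x∈⁅y⁆⇒x≡y e e′∈) (sym (x∈⁅y⁆⇒x≡y e f′∈))

rainbow⇒indep : ∀ {k} (v : Rep m n) (c : Fin n → Fin k) → RainbowCircuitFree v c →
  ∀ {X} → Rainbow c X → Indep v X
rainbow⇒indep v c rcf rainbow Y Y⊆X zs ne with dependent⇒⊇circuit v Y ne zs
... | C , C⊆Y , circuit with rcf C circuit
...   | e , f , e≢f , e∈C , f∈C , same = e≢f (rainbow (Y⊆X (C⊆Y e∈C)) (Y⊆X (C⊆Y f∈C)) same)

∈ColorClass⁻ : ∀ {k} {c : Fin n → Fin k} {j e} → e ∈ ColorClass c j → c e ≡ j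
∈ColorClass⁻ {c = c} {j} = ∈-tabulate⁻ (λ e → c e ≟ j)

∈ColorClass⁺ : ∀ {k} {c : Fin n → Fin k} {j e} → c e ≡ j → e ∈ ColorClass c j
∈ColorClass⁺ {c = c} {j} = ∈-tabulate⁺ (λ e → c e ≟ j)

⊆⁅⁆⇒∣∣≤1 : ∀ {I : Subset n} {x} → I ⊆ ⁅ x ⁆ → ∣ I ∣ ≤ 1
⊆⁅⁆⇒∣∣≤1 {x = x} I⊆ = subst (_ ≤_) (SP.∣⁅x⁆∣≡1 x) (SP.p⊆q⇒∣p∣≤∣q∣ I⊆)

⊆pair⇒⊆⁅⁆ : ∀ {I : Subset n} {x y} → I ⊆ ⁅ x ⁆ ∪ ⁅ y ⁆ → x ∉ I → I ⊆ ⁅ y ⁆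
⊆pair⇒⊆⁅⁆ {x = x} {y} I⊆ x∉I z∈I with x∈p∪q⁻ ⁅ x ⁆ ⁅ y ⁆ (I⊆ z∈I)
... | inj₁ z∈x = ⊥-elim (x∉I (subst (_∈ _) (x∈⁅y⁆⇒x≡y x z∈x) z∈I))
... | inj₂ z∈y = z∈y

indep⇒rank-⁅⁆ : ∀ (v : Rep m n) {e} → Indep v ⁅ e ⁆ → IsRank v ⁅ e ⁆ 1
indep⇒rank-⁅⁆ v {e} indep = (⁅ e ⁆ , ⊆-refl , indep , SP.∣⁅x⁆∣≡1 e) , λ I I⊆ _ → ⊆⁅⁆⇒∣∣≤1 I⊆

equal-columns⇒parallel : ∀ (v : Rep m n) {e f} → e ≢ f → Indep v ⁅ e ⁆ → Indep v ⁅ f ⁆ →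
  (∀ k → v e k ≡ v f k) → Parallel v e f
equal-columns⇒parallel v {e} {f} e≢f indep-e indep-f same =
  indep⇒rank-⁅⁆ v indep-e , indep⇒rank-⁅⁆ v indep-f ,
  (⁅ e ⁆ , p⊆p∪q ⁅ f ⁆ , indep-e , SP.∣⁅x⁆∣≡1 e) , pair-bound
  where
  pair-bound : ∀ I → I ⊆ ⁅ e ⁆ ∪ ⁅ f ⁆ → Indep v I → ∣ I ∣ ≤ 1
  pair-bound I I⊆ indep with e ∈? I | f ∈? I
  ... | no e∉I | _ = ⊆⁅⁆⇒∣∣≤1 (⊆pair⇒⊆⁅⁆ I⊆ e∉I)
  ... | yes _ | no f∉I = ⊆⁅⁆⇒∣∣≤1 (⊆pair⇒⊆⁅⁆ (subst (λ Y → I ⊆ Y) (SP.∪-comm ⁅ e ⁆ ⁅ f ⁆) I⊆) f∉I)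
  ... | yes e∈I | yes f∈I = ⊥-elim (indep (⁅ e ⁆ ⊕ ⁅ f ⁆) W⊆I zeroSum (e , e∈W))
    where
    W⊆I : ⁅ e ⁆ ⊕ ⁅ f ⁆ ⊆ I
    W⊆I z∈ with x∈p∪q⁻ ⁅ e ⁆ ⁅ f ⁆ (⊕⊆∪ ⁅ e ⁆ ⁅ f ⁆ z∈)
    ... | inj₁ z∈e = subst (_∈ I) (sym (x∈⁅y⁆⇒x≡y e z∈e)) e∈I
    ... | inj₂ z∈f = subst (_∈ I) (sym (x∈⁅y⁆⇒x≡y f z∈f)) f∈I

    zeroSum : ZeroSum v (⁅ e ⁆ ⊕ ⁅ f ⁆)
    zeroSum k = trans (sumOver-⊕ v ⁅ e ⁆ ⁅ f ⁆ k)
      (trans (cong₂ _xor_ (trans (sumOver-⁅⁆ v e k) (same k)) (sumOver-⁅⁆ v f k)) (xor-same (v f k)))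

    e∈W : e ∈ ⁅ e ⁆ ⊕ ⁅ f ⁆
    e∈W = ∈-⊕⁺ ⁅ e ⁆ ⁅ f ⁆ (inj₁ (x∈⁅x⁆ e , x≢y⇒x∉⁅y⁆ e≢f))

module RainbowCircuitFreeColouring
  {m n r} (v : Rep m n) (c : Fin n → Fin r) (rcf : RainbowCircuitFree v c)
  (rank≤ : ∀ I → I ⊆ ⊤ → Indep v I → ∣ I ∣ ≤ r)
  (a : Fin r → Fin n) (c∘a : ∀ j → c (a j) ≡ j) where

  rainbow-zeroSum⇒empty : ∀ {W} → Rainbow c W → ZeroSum v W → ¬ Nonempty W
  rainbow-zeroSum⇒empty rainbow = rainbow⇒indep v c rcf rainbow _ ⊆-refl

  A : Subset n
  A = tabulate (λ e → does (e ≟ a (c e)))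

  ∈A⁻ : ∀ {e} → e ∈ A → e ≡ a (c e)
  ∈A⁻ = ∈-tabulate⁻ (λ e → e ≟ a (c e))

  a∈A : ∀ j → a j ∈ A
  a∈A j = ∈-tabulate⁺ (λ e → e ≟ a (c e)) (cong a (sym (c∘a j)))

  a-injective : Injective _≡_ _≡_ a
  a-injective {i} {j} eq = trans (sym (c∘a i)) (trans (cong c eq) (c∘a j))

  ⊆A⇒rainbow : ∀ {X} → X ⊆ A → Rainbow c X
  ⊆A⇒rainbow X⊆A e∈ f∈ same = trans (∈A⁻ (X⊆A e∈)) (trans (cong a same) (sym (∈A⁻ (X⊆A f∈))))

  Expresses : Fin n → Subset n → Set
  Expresses e Y = Y ⊆ A × (∀ k → v e k ≡ sumOver v Y k)

  ∣A∪⁅e⁆∣ : ∀ {e} → e ∉ A → suc r ≤ ∣ A ∪ ⁅ e ⁆ ∣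
  ∣A∪⁅e⁆∣ {e} e∉A = injective⇒≤∣∣ g g-injective g∈
    where
    g : Fin (suc r) → Fin n
    g fzero = e
    g (fsuc j) = a j

    e≢a : ∀ {j} → e ≢ a j
    e≢a refl = e∉A (a∈A _)

    g-injective : Injective _≡_ _≡_ g
    g-injective {fzero} {fzero} _ = refl
    g-injective {fzero} {fsuc j} eq = ⊥-elim (e≢a eq)
    g-injective {fsuc i} {fzero} eq = ⊥-elim (e≢a (sym eq))
    g-injective {fsuc i} {fsuc j} eq = cong fsuc (a-injective eq)

    g∈ : ∀ i → g i ∈ A ∪ ⁅ e ⁆
    g∈ fzero = q⊆p∪q A ⁅ e ⁆ (x∈⁅x⁆ e)
    g∈ (fsuc j) = p⊆p∪q ⁅ e ⁆ (a∈A j)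

  unexpressed⇒A∪⁅e⁆-indep : ∀ {e} → ¬ ∃ (Expresses e) → Indep v (A ∪ ⁅ e ⁆)
  unexpressed⇒A∪⁅e⁆-indep {e} none W W⊆ zs ne with e ∈? W
  ... | no e∉W = rainbow-zeroSum⇒empty
    (⊆A⇒rainbow (λ x∈W → x∈p∪⁅y⁆⇒x∈p (W⊆ x∈W) (λ { refl → e∉W x∈W }))) zs ne
  ... | yes e∈W = none (W ⊕ ⁅ e ⁆ , W⊕e⊆A , λ k → sym (W⊕e-sum k))
    where
    W⊕e⊆A : W ⊕ ⁅ e ⁆ ⊆ A
    W⊕e⊆A x∈ with ∈-⊕⁻ W ⁅ e ⁆ x∈
    ... | inj₁ (x∈W , x∉e) = x∈p∪⁅y⁆⇒x∈p (W⊆ x∈W) (λ { refl → x∉e (x∈⁅x⁆ e) })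
    ... | inj₂ (x∉W , x∈e) = ⊥-elim (x∉W (subst (_∈ W) (sym (x∈⁅y⁆⇒x≡y e x∈e)) e∈W))

    W⊕e-sum : ∀ k → sumOver v (W ⊕ ⁅ e ⁆) k ≡ v e k
    W⊕e-sum k = trans (sumOver-⊕ v W ⁅ e ⁆ k) (cong₂ _xor_ (zs k) (sumOver-⁅⁆ v e k))

  -- Were e outside the span of A, then A ∪ {e} would be independent of size r + 1.
  spanned : ∀ e → ∃ (Expresses e)
  spanned e with anySubset? (λ Y → (Y ⊆? A) ×-dec all? (λ k → v e k BP.≟ sumOver v Y k))
  ... | yes expression = expression
  ... | no none = ⊥-elim (NP.<-irrefl refl
    (≤-trans (∣A∪⁅e⁆∣ e∉A) (rank≤ (A ∪ ⁅ e ⁆) (λ _ → ∈⊤) (unexpressed⇒A∪⁅e⁆-indep none))))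
    where
    e∉A : e ∉ A
    e∉A e∈A = none (⁅ e ⁆ , (λ x∈ → subst (_∈ A) (sym (x∈⁅y⁆⇒x≡y e x∈)) e∈A) , λ k → sym (sumOver-⁅⁆ v e k))

  coords : Fin n → Subset n
  coords e = proj₁ (spanned e)

  coords⊆A : ∀ e → coords e ⊆ A
  coords⊆A e = proj₁ (proj₂ (spanned e))

  v≡sum-coords : ∀ e k → v e k ≡ sumOver v (coords e) k
  v≡sum-coords e = proj₂ (proj₂ (spanned e))

  Coords : Rep n n
  Coords e = lookup (coords e)

  coord : Fin n → Fin r → Bool
  coord e k = Coords e (a k)

  sumOver-coords : ∀ X k → sumOver v X k ≡ sumOver v (symDiffOver coords X) k
  sumOver-coords = sumOver-symDiffOver v v coords v≡sum-coords

  lookup-coords : ∀ X y → lookup (symDiffOver coords X) y ≡ sumOver Coords X y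
  lookup-coords = lookup-symDiffOver coords

  symDiffOver-coords⊆A : ∀ X → symDiffOver coords X ⊆ A
  symDiffOver-coords⊆A X {x} x∈ with x ∈? A
  ... | yes x∈A = x∈A
  ... | no x∉A = ⊥-elim (lookup-false⇒∉ (trans (lookup-coords X x) (sumOver-vanishes Coords X x outside)) x∈)
    where
    outside : ∀ e → e ∈ X → Coords e x ≡ false
    outside e _ = ∉⇒lookup (λ x∈coords → x∉A (coords⊆A e x∈coords))

  zeroSum⇒coords-empty : ∀ {X} → ZeroSum v X → ∀ x → x ∉ symDiffOver coords X
  zeroSum⇒coords-empty {X} zs x x∈ = rainbow-zeroSum⇒empty
    (⊆A⇒rainbow (symDiffOver-coords⊆A X)) (λ k → trans (sym (sumOver-coords X k)) (zs k)) (x , x∈)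

  ⊕-coords-zeroSum : ∀ X → ZeroSum v (X ⊕ symDiffOver coords X)
  ⊕-coords-zeroSum X k = begin
    sumOver v (X ⊕ Z) k            ≡⟨ sumOver-⊕ v X Z k ⟩
    sumOver v X k xor sumOver v Z k ≡⟨ cong (_xor sumOver v Z k) (sumOver-coords X k) ⟩
    sumOver v Z k xor sumOver v Z k ≡⟨ xor-same (sumOver v Z k) ⟩
    false                          ∎
    where
    open ≡-Reasoning
    Z = symDiffOver coords X

  zeroSum⇒coords-vanish : ∀ {W} → ZeroSum v W → ∀ y → sumOver Coords W y ≡ false
  zeroSum⇒coords-vanish {W} zs y = trans (sym (lookup-coords W y)) (∉⇒lookup (zeroSum⇒coords-empty zs y))

  -- Otherwise {e} together with its coordinates would be a rainbow zero-sum set.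
  coord-own-colour : ∀ e → coord e (c e) ≡ true
  coord-own-colour e with coord e (c e) in own
  ... | true = refl
  ... | false = ⊥-elim (rainbow-zeroSum⇒empty rainbow zeroSum (e , e∈W))
    where
    W = ⁅ e ⁆ ⊕ coords e

    e∉coords : e ∉ coords e
    e∉coords e∈ = lookup-false⇒∉ own (subst (_∈ coords e) (∈A⁻ (coords⊆A e e∈)) e∈)

    e∈W : e ∈ W
    e∈W = ∈-⊕⁺ ⁅ e ⁆ (coords e) (inj₁ (x∈⁅x⁆ e , e∉coords))

    zeroSum : ZeroSum v W
    zeroSum k = trans (sumOver-⊕ v ⁅ e ⁆ (coords e) k)
      (trans (cong₂ _xor_ (sumOver-⁅⁆ v e k) (sym (v≡sum-coords e k))) (xor-same (v e k)))

    apart : ∀ {x y} → x ∈ ⁅ e ⁆ → y ∈ coords e → c x ≢ c y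
    apart x∈ y∈ same with x∈⁅y⁆⇒x≡y e x∈
    ... | refl = lookup-false⇒∉ own (subst (_∈ coords e) (trans (∈A⁻ (coords⊆A e y∈)) (cong a (sym same))) y∈)

    rainbow : Rainbow c W
    rainbow = rainbow-⊆ (⊕⊆∪ ⁅ e ⁆ (coords e)) (rainbow-∪ (rainbow-⁅⁆ e) (⊆A⇒rainbow (coords⊆A e)) apart)

  Sink : Subset r → Fin r → Set
  Sink R j = ∀ {e k} → c e ≡ j → k ∈ R → coord e k ≡ true → k ≡ j

  Feeder : Subset r → Fin r → Set
  Feeder R j = ∃₂ λ e k → c e ≡ j × k ∈ R × coord e k ≡ true × k ≢ j

  sink-or-feeder : ∀ R j → Sink R j ⊎ Feeder R j
  sink-or-feeder R j
    with any? (λ e → any? (λ k → (c e ≟ j) ×-dec (k ∈? R) ×-dec (coord e k BP.≟ true) ×-dec ¬? (k ≟ j)))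
  ... | yes (e , k , feeds) = inj₂ (e , k , feeds)
  ... | no none = inj₁ sink
    where
    sink : Sink R j
    sink {e} {k} ce k∈R coordₖ with k ≟ j
    ... | yes k≡j = k≡j
    ... | no k≢j = ⊥-elim (none (e , k , ce , k∈R , coordₖ , k≢j))

  sink? : ∀ R → Dec (∃ λ j → j ∈ R × Sink R j)
  sink? R = any? (λ j → (j ∈? R) ×-dec isSink? j)
    where
    isSink? : ∀ j → Dec (Sink R j)
    isSink? j with sink-or-feeder R j
    ... | inj₁ sink = yes sink
    ... | inj₂ (e , k , ce , k∈R , coordₖ , k≢j) = no (λ sink → k≢j (sink ce k∈R coordₖ))

  -- The sinks σ q of the sets R - q form a permutation of R. Picking for each j ∈ R an element of
  -- colour j with a coordinate at σ⁻¹ j gives a rainbow set X whose coordinates inside R cancel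
  -- in pairs; X together with its coordinates, which lie outside R, then has zero sum.
  module MinimalSinkFree
    (R : Subset r) (no-sink : ¬ ∃ λ j → j ∈ R × Sink R j)
    (sink-without : ∀ {q} → q ∈ R → ∃ λ j → j ∈ R - q × Sink (R - q) j) where

    record Successor (q s : Fin r) (w : Fin n) : Set where
      field
        s∈R : s ∈ R
        s≢q : s ≢ q
        sink : Sink (R - q) s
        c-w : c w ≡ s
        coord-w : coord w q ≡ true

    successor : ∀ {q} → q ∈ R → ∃₂ (Successor q)
    successor {q} q∈R with sink-without q∈R
    ... | s , s∈R-q , sink with sink-or-feeder R s
    ...   | inj₁ sinkR = ⊥-elim (no-sink (s , proj₁ (x∈p-y⁻ s∈R-q) , sinkR))
    ...   | inj₂ (w , k , c-w , k∈R , coord-w , k≢s) with k ≟ q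
    ...     | yes refl = s , w , record
                { s∈R = proj₁ (x∈p-y⁻ s∈R-q) ; s≢q = proj₂ (x∈p-y⁻ s∈R-q) ; sink = sink
                ; c-w = c-w ; coord-w = coord-w }
    ...     | no k≢q = ⊥-elim (k≢s (sink c-w (x∈p∧x≢y⇒x∈p-y k∈R k≢q) coord-w))

    σ : Fin r → Fin r
    σ q with q ∈? R
    ... | yes q∈R = proj₁ (successor q∈R)
    ... | no _ = q

    w : Fin r → Fin n
    w q with q ∈? R
    ... | yes q∈R = proj₁ (proj₂ (successor q∈R))
    ... | no _ = a q

    σ-spec : ∀ {q} → q ∈ R → Successor q (σ q) (w q)
    σ-spec {q} q∈R with q ∈? R
    ... | yes q∈R′ = proj₂ (proj₂ (successor q∈R′))
    ... | no q∉R = ⊥-elim (q∉R q∈R)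

    σ-outside : ∀ {q} → q ∉ R → σ q ≡ q
    σ-outside {q} q∉R with q ∈? R
    ... | yes q∈R = ⊥-elim (q∉R q∈R)
    ... | no _ = refl

    open Successor

    σ∈R : ∀ {q} → q ∈ R → σ q ∈ R
    σ∈R q∈R = s∈R (σ-spec q∈R)

    coords-of-colour-σ : ∀ {q e k} → q ∈ R → c e ≡ σ q → k ∈ R → coord e k ≡ true → k ≡ q ⊎ k ≡ σ q
    coords-of-colour-σ {q} {k = k} q∈R ce k∈R coordₖ with k ≟ q
    ... | yes k≡q = inj₁ k≡q
    ... | no k≢q = inj₂ (sink (σ-spec q∈R) ce (x∈p∧x≢y⇒x∈p-y k∈R k≢q) coordₖ)

    σ-injective-on-R : ∀ {q q′} → q ∈ R → q′ ∈ R → σ q ≡ σ q′ → q ≡ q′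
    σ-injective-on-R {q} {q′} q∈R q′∈R eq
      with coords-of-colour-σ q′∈R (trans (c-w (σ-spec q∈R)) eq) q∈R (coord-w (σ-spec q∈R))
    ... | inj₁ q≡q′ = q≡q′
    ... | inj₂ q≡σq′ = ⊥-elim (s≢q (σ-spec q∈R) (sym (trans q≡σq′ (sym eq))))

    σ-injective : Injective _≡_ _≡_ σ
    σ-injective {q} {q′} eq = by-membership (q ∈? R) (q′ ∈? R)
      where
      by-membership : Dec (q ∈ R) → Dec (q′ ∈ R) → q ≡ q′
      by-membership (yes q∈R) (yes q′∈R) = σ-injective-on-R q∈R q′∈R eq
      by-membership (yes q∈R) (no q′∉R) = ⊥-elim (q′∉R (subst (_∈ R) (trans eq (σ-outside q′∉R)) (σ∈R q∈R)))
      by-membership (no q∉R) (yes q′∈R) = ⊥-elim (q∉R (subst (_∈ R) (trans (sym eq) (σ-outside q∉R)) (σ∈R q′∈R)))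
      by-membership (no q∉R) (no q′∉R) = trans (sym (σ-outside q∉R)) (trans eq (σ-outside q′∉R))

    σ⁻¹ : Fin r → Fin r
    σ⁻¹ j = proj₁ (injective⇒surjective σ σ-injective j)

    σ∘σ⁻¹ : ∀ j → σ (σ⁻¹ j) ≡ j
    σ∘σ⁻¹ j = proj₂ (injective⇒surjective σ σ-injective j)

    σ⁻¹∘σ : ∀ q → σ⁻¹ (σ q) ≡ q
    σ⁻¹∘σ q = σ-injective (σ∘σ⁻¹ (σ q))

    σ⁻¹∈R : ∀ {j} → j ∈ R → σ⁻¹ j ∈ R
    σ⁻¹∈R {j} j∈R with σ⁻¹ j ∈? R
    ... | yes q∈R = q∈R
    ... | no q∉R = ⊥-elim (q∉R (subst (_∈ R) (trans (sym (σ∘σ⁻¹ j)) (σ-outside q∉R)) j∈R))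

    pick : Fin r → Fin n
    pick j = w (σ⁻¹ j)

    c-pick : ∀ {j} → j ∈ R → c (pick j) ≡ j
    c-pick {j} j∈R = trans (c-w (σ-spec (σ⁻¹∈R j∈R))) (σ∘σ⁻¹ j)

    coords-of-pick : ∀ {j k} → j ∈ R → k ∈ R → coord (pick j) k ≡ true → k ≡ σ⁻¹ j ⊎ k ≡ j
    coords-of-pick {j} j∈R k∈R coordₖ
      with coords-of-colour-σ (σ⁻¹∈R j∈R) (c-w (σ-spec (σ⁻¹∈R j∈R))) k∈R coordₖ
    ... | inj₁ k≡σ⁻¹j = inj₁ k≡σ⁻¹j
    ... | inj₂ k≡j = inj₂ (trans k≡j (σ∘σ⁻¹ j))

    coord-pick-own : ∀ {k} → k ∈ R → coord (pick k) k ≡ true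
    coord-pick-own {k} k∈R = subst (λ j → coord (pick k) j ≡ true) (c-pick k∈R) (coord-own-colour (pick k))

    coord-pick-σ : ∀ {k} → k ∈ R → coord (pick (σ k)) k ≡ true
    coord-pick-σ {k} k∈R rewrite σ⁻¹∘σ k = coord-w (σ-spec k∈R)

    pick≢pick-σ : ∀ {k} → k ∈ R → pick k ≢ pick (σ k)
    pick≢pick-σ {k} k∈R eq = s≢q (σ-spec k∈R) (trans (sym (c-pick (σ∈R k∈R))) (trans (cong c (sym eq)) (c-pick k∈R)))

    Picked : Fin n → Set
    Picked e = c e ∈ R × e ≡ pick (c e)

    X : Subset n
    X = tabulate (λ e → does ((c e ∈? R) ×-dec (e ≟ pick (c e))))

    ∈X⁻ : ∀ {e} → e ∈ X → Picked e
    ∈X⁻ = ∈-tabulate⁻ (λ e → (c e ∈? R) ×-dec (e ≟ pick (c e)))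

    pick∈X : ∀ {j} → j ∈ R → pick j ∈ X
    pick∈X {j} j∈R = ∈-tabulate⁺ (λ e → (c e ∈? R) ×-dec (e ≟ pick (c e)))
      (subst (_∈ R) (sym (c-pick j∈R)) j∈R , cong pick (sym (c-pick j∈R)))

    -- Exactly pick k and pick (σ k) have a coordinate at k.
    X-coord-vanishes : ∀ {k} → k ∈ R → sumOver Coords X (a k) ≡ false
    X-coord-vanishes {k} k∈R = begin
      sumOver Coords X (a k)                                   ≡⟨ sumOver-cong Coords (a k) agree ⟩
      sumOver Coords (⁅ pick k ⁆ ⊕ ⁅ pick (σ k) ⁆) (a k)          ≡⟨ sumOver-⊕ Coords ⁅ _ ⁆ ⁅ _ ⁆ (a k) ⟩
      sumOver Coords ⁅ pick k ⁆ (a k) xor sumOver Coords ⁅ pick (σ k) ⁆ (a k)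
        ≡⟨ cong₂ _xor_ (trans (sumOver-⁅⁆ Coords _ (a k)) (coord-pick-own k∈R))
                       (trans (sumOver-⁅⁆ Coords _ (a k)) (coord-pick-σ k∈R)) ⟩
      false                                                    ∎
      where
      open ≡-Reasoning
      Y = ⁅ pick k ⁆ ⊕ ⁅ pick (σ k) ⁆

      pick-k∈Y : pick k ∈ Y
      pick-k∈Y = ∈-⊕⁺ ⁅ _ ⁆ ⁅ _ ⁆ (inj₁ (x∈⁅x⁆ _ , x≢y⇒x∉⁅y⁆ (pick≢pick-σ k∈R)))

      pick-σk∈Y : pick (σ k) ∈ Y
      pick-σk∈Y = ∈-⊕⁺ ⁅ _ ⁆ ⁅ _ ⁆ (inj₂ (x≢y⇒x∉⁅y⁆ (λ eq → pick≢pick-σ k∈R (sym eq)) , x∈⁅x⁆ _))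

      X→Y : ∀ {e} → coord e k ≡ true → e ∈ X → e ∈ Y
      X→Y {e} coordₖ e∈X with ∈X⁻ e∈X
      ... | ce∈R , e≡pick = subst (_∈ Y) (sym e≡pick) (pick-ce∈Y (coords-of-pick ce∈R k∈R coord-pickₖ))
        where
        coord-pickₖ : coord (pick (c e)) k ≡ true
        coord-pickₖ = subst (λ x → coord x k ≡ true) e≡pick coordₖ
        pick-ce∈Y : k ≡ σ⁻¹ (c e) ⊎ k ≡ c e → pick (c e) ∈ Y
        pick-ce∈Y (inj₁ k≡σ⁻¹ce) = subst (λ j → pick j ∈ Y) (trans (cong σ k≡σ⁻¹ce) (σ∘σ⁻¹ (c e))) pick-σk∈Y
        pick-ce∈Y (inj₂ k≡ce) = subst (λ j → pick j ∈ Y) k≡ce pick-k∈Y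

      Y→X : ∀ {e} → e ∈ Y → e ∈ X
      Y→X e∈Y with ∈-⊕⁻ ⁅ _ ⁆ ⁅ _ ⁆ e∈Y
      ... | inj₁ (e∈ , _) = subst (_∈ X) (sym (x∈⁅y⁆⇒x≡y _ e∈)) (pick∈X k∈R)
      ... | inj₂ (_ , e∈) = subst (_∈ X) (sym (x∈⁅y⁆⇒x≡y _ e∈)) (pick∈X (σ∈R k∈R))

      agree : ∀ e → Coords e (a k) ≡ true → lookup X e ≡ lookup Y e
      agree e coordₖ = lookup-cong (X→Y coordₖ) Y→X

    Z : Subset n
    Z = symDiffOver coords X

    Z-outside-R : ∀ {x} → x ∈ Z → c x ∉ R
    Z-outside-R {x} x∈Z cx∈R = lookup-false⇒∉ vanishes x∈Z
      where
      vanishes : lookup Z x ≡ false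
      vanishes = begin
        lookup Z x                  ≡⟨ lookup-coords X x ⟩
        sumOver Coords X x          ≡⟨ cong (sumOver Coords X) (∈A⁻ (symDiffOver-coords⊆A X x∈Z)) ⟩
        sumOver Coords X (a (c x))  ≡⟨ X-coord-vanishes cx∈R ⟩
        false                       ∎
        where open ≡-Reasoning

    empty : ¬ Nonempty R
    empty (k , k∈R) = rainbow-zeroSum⇒empty rainbow (⊕-coords-zeroSum X) (pick k , pick-k∈W)
      where
      X-rainbow : Rainbow c X
      X-rainbow e∈ f∈ same = trans (proj₂ (∈X⁻ e∈)) (trans (cong pick same) (sym (proj₂ (∈X⁻ f∈))))

      rainbow : Rainbow c (X ⊕ Z)
      rainbow = rainbow-⊆ (⊕⊆∪ X Z) (rainbow-∪ X-rainbow (⊆A⇒rainbow (symDiffOver-coords⊆A X))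
        (λ x∈X y∈Z same → Z-outside-R y∈Z (subst (_∈ R) same (proj₁ (∈X⁻ x∈X)))))

      pick-k∈W : pick k ∈ X ⊕ Z
      pick-k∈W = ∈-⊕⁺ X Z (inj₁ (pick∈X k∈R , λ ∈Z → Z-outside-R ∈Z (subst (_∈ R) (sym (c-pick k∈R)) k∈R)))

  sink-exists : ∀ R → Nonempty R → ∃ λ j → j ∈ R × Sink R j
  sink-exists R = go R (⊂-wellFounded R)
    where
    go : ∀ R → Acc _⊊_ R → Nonempty R → ∃ λ j → j ∈ R × Sink R j
    go R (acc smaller) ne with sink? R
    ... | yes sink = sink
    ... | no no-sink = ⊥-elim (MinimalSinkFree.empty R no-sink sink-without ne)
      where
      nonempty-without : ∀ {q} → q ∈ R → Nonempty (R - q)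
      nonempty-without {q} q∈R with any? (λ j → (j ∈? R) ×-dec ¬? (j ≟ q))
      ... | yes (j , j∈R , j≢q) = j , x∈p∧x≢y⇒x∈p-y j∈R j≢q
      ... | no none = ⊥-elim (no-sink (q , q∈R , only-q))
        where
        only-q : Sink R q
        only-q {k = k} _ k∈R _ with k ≟ q
        ... | yes k≡q = k≡q
        ... | no k≢q = ⊥-elim (none (k , k∈R , k≢q))

      sink-without : ∀ {q} → q ∈ R → ∃ λ j → j ∈ R - q × Sink (R - q) j
      sink-without q∈R = go _ (smaller (x∈p⇒p-x⊂p q∈R)) (nonempty-without q∈R)

  record Ranking (R : Subset r) (h : Fin r → ℕ) : Set where
    field
      injective : ∀ {j k} → j ∈ R → k ∈ R → h j ≡ h k → j ≡ k
      bounded : ∀ {j} → j ∈ R → h j < ∣ R ∣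
      monotone : ∀ {e k} → c e ∈ R → k ∈ R → coord e k ≡ true → k ≢ c e → h k < h (c e)

  raise : Fin r → (Fin r → ℕ) → Fin r → ℕ
  raise s h j with j ≟ s
  ... | yes _ = 0
  ... | no _ = suc (h j)

  ranking-step : ∀ {R s h} → s ∈ R → Sink R s → Ranking (R - s) h → Ranking R (raise s h)
  ranking-step {R} {s} {h} s∈R sink ranking = record
    { injective = injective ; bounded = bounded ; monotone = monotone }
    where
    open Ranking ranking renaming (injective to injective′; bounded to bounded′; monotone to monotone′)

    injective : ∀ {j k} → j ∈ R → k ∈ R → raise s h j ≡ raise s h k → j ≡ k
    injective {j} {k} j∈R k∈R eq with j ≟ s | k ≟ s
    ... | yes refl | yes refl = refl
    ... | yes refl | no k≢s = ⊥-elim (NP.0≢1+n eq)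
    ... | no j≢s | yes refl = ⊥-elim (NP.0≢1+n (sym eq))
    ... | no j≢s | no k≢s =
      injective′ (x∈p∧x≢y⇒x∈p-y j∈R j≢s) (x∈p∧x≢y⇒x∈p-y k∈R k≢s) (NP.suc-injective eq)

    bounded : ∀ {j} → j ∈ R → raise s h j < ∣ R ∣
    bounded {j} j∈R with j ≟ s
    ... | yes refl = ≤-trans (s≤s z≤n) (x∈p⇒∣p-x∣<∣p∣ s∈R)
    ... | no j≢s = ≤-trans (s≤s (bounded′ (x∈p∧x≢y⇒x∈p-y j∈R j≢s))) (x∈p⇒∣p-x∣<∣p∣ s∈R)

    monotone : ∀ {e k} → c e ∈ R → k ∈ R → coord e k ≡ true → k ≢ c e → raise s h k < raise s h (c e)
    monotone {e} {k} ce∈R k∈R coordₖ k≢ce with c e ≟ s | k ≟ s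
    ... | yes ce≡s | _ = ⊥-elim (k≢ce (trans (sink ce≡s k∈R coordₖ) (sym ce≡s)))
    ... | no ce≢s | yes refl = s≤s z≤n
    ... | no ce≢s | no k≢s =
      s≤s (monotone′ (x∈p∧x≢y⇒x∈p-y ce∈R ce≢s) (x∈p∧x≢y⇒x∈p-y k∈R k≢s) coordₖ k≢ce)

  ranking : ∀ R → ∃ (Ranking R)
  ranking R = go R (⊂-wellFounded R)
    where
    go : ∀ R → Acc _⊊_ R → ∃ (Ranking R)
    go R (acc smaller) with nonempty? R
    ... | no empty = (λ _ → 0) , record
      { injective = λ j∈R _ _ → ⊥-elim (empty (_ , j∈R))
      ; bounded = λ j∈R → ⊥-elim (empty (_ , j∈R))
      ; monotone = λ _ k∈R _ _ → ⊥-elim (empty (_ , k∈R)) }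
    ... | yes nonempty with sink-exists R nonempty
    ...   | s , s∈R , sink = _ , ranking-step s∈R sink (proj₂ (go (R - s) (smaller (x∈p⇒p-x⊂p s∈R))))

  opaque
    height : Fin r → ℕ
    height = proj₁ (ranking ⊤)

    height-ranks : Ranking ⊤ height
    height-ranks = proj₂ (ranking ⊤)

  height<r : ∀ j → height j < r
  height<r j = subst (height j <_) (SP.∣⊤∣≡n r) (Ranking.bounded height-ranks ∈⊤)

  position : Fin r → Fin r
  position j = F.fromℕ< (height<r j)

  toℕ-position : ∀ j → F.toℕ (position j) ≡ height j
  toℕ-position j = FP.toℕ-fromℕ< (height<r j)

  position-injective : Injective _≡_ _≡_ position
  position-injective {j} {k} eq = Ranking.injective height-ranks ∈⊤ ∈⊤
    (trans (sym (toℕ-position j)) (trans (cong F.toℕ eq) (toℕ-position k)))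

  triangular : ∀ {e k} → coord e k ≡ true → position k F.≤ position (c e)
  triangular {e} {k} coordₖ rewrite toℕ-position k | toℕ-position (c e) with k ≟ c e
  ... | yes refl = NP.≤-refl
  ... | no k≢ce = NP.<⇒≤ (Ranking.monotone height-ranks ∈⊤ ∈⊤ coordₖ k≢ce)

  opaque
    colourAt : Fin r → Fin r
    colourAt i = proj₁ (injective⇒surjective position position-injective i)

    position∘colourAt : ∀ i → position (colourAt i) ≡ i
    position∘colourAt i = proj₂ (injective⇒surjective position position-injective i)

  colourAt∘position : ∀ j → colourAt (position j) ≡ j
  colourAt∘position j = position-injective (position∘colourAt (position j))

  π : Permutation′ r
  π = permutation colourAt position colourAt∘position position∘colourAt

  ∈-PrefixUnion⁻ : ∀ {i e} → e ∈ PrefixUnion c π i → position (c e) F.≤ i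
  ∈-PrefixUnion⁻ {i} e∈ with ∈-⋃⁻ _ e∈
  ... | P , P∈ , e∈P with ListP.∈-map⁻ (λ j → ColorClass c (colourAt j)) P∈
  ...   | j , j∈ , refl = subst (F._≤ i) (sym (trans (cong position (∈ColorClass⁻ {c = c} e∈P)) (position∘colourAt j)))
                            (proj₂ (ListP.∈-filter⁻ (F._≤? i) {xs = L.allFin r} j∈))

  ∈-PrefixUnion⁺ : ∀ {i e} → position (c e) F.≤ i → e ∈ PrefixUnion c π i
  ∈-PrefixUnion⁺ {i} {e} pos≤i = ∈-⋃⁺
    (ListP.∈-map⁺ (λ j → ColorClass c (colourAt j))
      (ListP.∈-filter⁺ (F._≤? i) (ListP.∈-allFin (position (c e))) pos≤i))
    (∈ColorClass⁺ {c = c} (sym (colourAt∘position (c e))))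

  coord-beyond : ∀ {e k} {i : Fin r} → position (c e) F.≤ i → i F.< position k → coord e k ≡ false
  coord-beyond ce≤i i<k = ¬-not λ coordₖ → NP.n≮n _ (NP.<-≤-trans i<k (NP.≤-trans (triangular coordₖ) ce≤i))

  module Cut (i : Fin r) where
    p : Fin r
    p = colourAt i

    P : Subset n
    P = PrefixUnion c π i

    S : Subset n
    S = ColorClass c p

    position-p : position p ≡ i
    position-p = position∘colourAt i

    ∈S⁻ : ∀ {e} → e ∈ S → c e ≡ p
    ∈S⁻ = ∈ColorClass⁻ {c = c}

    S⊆P : S ⊆ P
    S⊆P e∈S = ∈-PrefixUnion⁺ (FP.≤-reflexive (trans (cong position (∈S⁻ e∈S)) position-p))

    ∈P⇒≤p : ∀ {x} → x ∈ P → position (c x) F.≤ position p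
    ∈P⇒≤p x∈P = subst (_ F.≤_) (sym position-p) (∈-PrefixUnion⁻ x∈P)

    coord-p⇒colour-p : ∀ {x} → x ∈ P → coord x p ≡ true → c x ≡ p
    coord-p⇒colour-p x∈P coord-p = position-injective (FP.≤-antisym (∈P⇒≤p x∈P) (triangular coord-p))

    coord-p-own : ∀ {x} → x ∈ S → coord x p ≡ true
    coord-p-own {x} x∈S = subst (λ k → coord x k ≡ true) (∈S⁻ x∈S) (coord-own-colour x)

    a-p∈S : a p ∈ S
    a-p∈S = ∈ColorClass⁺ {c = c} (c∘a p)

    -- A basis avoiding S could be extended by a p: within P, only a p has a coordinate at p.
    meets : MeetsAllBases v P S
    meets B (B⊆P , indB , maximal) with nonempty? (S ∩ B)
    ... | yes meet = meet
    ... | no disjoint = ⊥-elim (disjoint (a p , SP.x∈p∩q⁺ (a-p∈S , a-p∈B)))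
      where
      B′ = B ∪ ⁅ a p ⁆

      B′⊆P : B′ ⊆ P
      B′⊆P x∈ with x∈p∪q⁻ B ⁅ a p ⁆ x∈
      ... | inj₁ x∈B = B⊆P x∈B
      ... | inj₂ x∈a-p = subst (_∈ P) (sym (x∈⁅y⁆⇒x≡y (a p) x∈a-p)) (S⊆P a-p∈S)

      indB′ : Indep v B′
      indB′ W W⊆B′ zs ne with a p ∈? W
      ... | no a-p∉W = indB W W⊆B zs ne
        where
        W⊆B : W ⊆ B
        W⊆B x∈W = x∈p∪⁅y⁆⇒x∈p (W⊆B′ x∈W) (λ { refl → a-p∉W x∈W })
      ... | yes a-p∈W = BP.not-¬ coord-W (zeroSum⇒coords-vanish zs (a p))
        where
        only-a-p : ∀ {x} → coord x p ≡ true → x ∈ W → x ∈ ⁅ a p ⁆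
        only-a-p coord-p x∈W with x∈p∪q⁻ B ⁅ a p ⁆ (W⊆B′ x∈W)
        ... | inj₂ x∈a-p = x∈a-p
        ... | inj₁ x∈B = ⊥-elim (disjoint (_ , SP.x∈p∩q⁺ (∈ColorClass⁺ {c = c} (coord-p⇒colour-p (B⊆P x∈B) coord-p) , x∈B)))

        coord-W : sumOver Coords W (a p) ≡ true
        coord-W = begin
          sumOver Coords W (a p)         ≡⟨ sumOver-cong Coords (a p) (λ x coord-p → lookup-cong (only-a-p coord-p)
                                              (λ x∈ → subst (_∈ W) (sym (x∈⁅y⁆⇒x≡y (a p) x∈)) a-p∈W)) ⟩
          sumOver Coords ⁅ a p ⁆ (a p)   ≡⟨ sumOver-⁅⁆ Coords (a p) (a p) ⟩
          coord (a p) p                  ≡⟨ coord-p-own a-p∈S ⟩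
          true                           ∎
          where open ≡-Reasoning

      a-p∈B : a p ∈ B
      a-p∈B = maximal B′ B′⊆P indB′ (p⊆p∪q ⁅ a p ⁆) (q⊆p∪q B ⁅ a p ⁆ (x∈⁅x⁆ (a p)))

    Below : Subset n
    Below = tabulate (λ e → does ((e ≟ a (c e)) ×-dec (position (c e) F.<? i)))

    ∈Below⁻ : ∀ {e} → e ∈ Below → e ≡ a (c e) × position (c e) F.< i
    ∈Below⁻ = ∈-tabulate⁻ (λ e → (e ≟ a (c e)) ×-dec (position (c e) F.<? i))

    a∈Below : ∀ {k} → position k F.< i → a k ∈ Below
    a∈Below {k} k<i = ∈-tabulate⁺ (λ e → (e ≟ a (c e)) ×-dec (position (c e) F.<? i))
      (cong a (sym (c∘a k)) , subst (λ j → position j F.< i) (sym (c∘a k)) k<i)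

    Below⊆A : Below ⊆ A
    Below⊆A e∈ = subst (_∈ A) (sym (proj₁ (∈Below⁻ e∈))) (a∈A _)

    Below⊆P : Below ⊆ P
    Below⊆P e∈ = ∈-PrefixUnion⁺ (NP.<⇒≤ (proj₂ (∈Below⁻ e∈)))

    ∉S-Below : ∀ {e} → e ∈ S → e ∉ Below
    ∉S-Below e∈S e∈ = NP.<-irrefl (cong F.toℕ (trans (cong position (∈S⁻ e∈S)) position-p)) (proj₂ (∈Below⁻ e∈))

    module BasisThrough (x : Fin n) (x∈S : x ∈ S) where
      B : Subset n
      B = ⁅ x ⁆ ∪ Below

      x∈B : x ∈ B
      x∈B = p⊆p∪q Below (x∈⁅x⁆ x)

      Below⊆B : Below ⊆ B
      Below⊆B = q⊆p∪q ⁅ x ⁆ Below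

      B∩S : ∀ {z} → z ∈ B → z ∈ S → z ≡ x
      B∩S z∈B z∈S with x∈p∪q⁻ ⁅ x ⁆ Below z∈B
      ... | inj₁ z∈x = x∈⁅y⁆⇒x≡y x z∈x
      ... | inj₂ z∈Below = ⊥-elim (∉S-Below z∈S z∈Below)

      B⊆P : B ⊆ P
      B⊆P z∈B with x∈p∪q⁻ ⁅ x ⁆ Below z∈B
      ... | inj₁ z∈x = subst (_∈ P) (sym (x∈⁅y⁆⇒x≡y x z∈x)) (S⊆P x∈S)
      ... | inj₂ z∈Below = Below⊆P z∈Below

      B-indep : Indep v B
      B-indep = rainbow⇒indep v c rcf (rainbow-∪ (rainbow-⁅⁆ x) (⊆A⇒rainbow Below⊆A) apart)
        where
        apart : ∀ {y z} → y ∈ ⁅ x ⁆ → z ∈ Below → c y ≢ c z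
        apart y∈ z∈ same rewrite x∈⁅y⁆⇒x≡y x y∈ = ∉S-Below (∈ColorClass⁺ {c = c} (trans (sym same) (∈S⁻ x∈S))) z∈

      -- Adding x to y when needed cancels the coordinate at p, leaving only coordinates below i.
      module Cancel (y : Fin n) (y∈P : y ∈ P) where
        b : Bool
        b = coord y p

        V : Subset n
        V = ⁅ y ⁆ ⊕ (if b then ⁅ x ⁆ else ⊥)

        Z : Subset n
        Z = symDiffOver coords V

        coord-Z : ∀ k → lookup Z (a k) ≡ coord y k xor (b ∧ coord x k)
        coord-Z k = begin
          lookup Z (a k)                                         ≡⟨ lookup-coords V (a k) ⟩
          sumOver Coords V (a k)                                 ≡⟨ sumOver-⊕ Coords ⁅ y ⁆ _ (a k) ⟩
          sumOver Coords ⁅ y ⁆ (a k) xor sumOver Coords (if b then ⁅ x ⁆ else ⊥) (a k)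
            ≡⟨ cong₂ _xor_ (sumOver-⁅⁆ Coords y (a k))
                 (trans (sumOver-scaled Coords b ⁅ x ⁆ (a k)) (cong (b ∧_) (sumOver-⁅⁆ Coords x (a k)))) ⟩
          coord y k xor (b ∧ coord x k)                          ∎
          where open ≡-Reasoning

        Z-below : ∀ k → lookup Z (a k) ≡ true → position k F.< i
        Z-below k Zₖ with FP.<-cmp (position k) i
        ... | tri< k<i _ _ = k<i
        ... | tri≈ _ k≡i _ = ⊥-elim (BP.not-¬ Zₖ (begin
          lookup Z (a k)                ≡⟨ coord-Z k ⟩
          coord y k xor (b ∧ coord x k)  ≡⟨ cong (λ j → coord y j xor (b ∧ coord x j)) k≡p ⟩
          b xor (b ∧ coord x p)          ≡⟨ cong (λ t → b xor (b ∧ t)) (coord-p-own x∈S) ⟩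
          b xor (b ∧ true)               ≡⟨ cong (b xor_) (BP.∧-identityʳ b) ⟩
          b xor b                        ≡⟨ xor-same b ⟩
          false                          ∎))
          where
          open ≡-Reasoning
          k≡p : k ≡ p
          k≡p = position-injective (trans k≡i (sym position-p))
        ... | tri> _ _ i<k = ⊥-elim (BP.not-¬ Zₖ (begin
          lookup Z (a k)                ≡⟨ coord-Z k ⟩
          coord y k xor (b ∧ coord x k)  ≡⟨ cong₂ (λ s t → s xor (b ∧ t))
                                              (coord-beyond (∈-PrefixUnion⁻ y∈P) i<k)
                                              (coord-beyond (∈-PrefixUnion⁻ (S⊆P x∈S)) i<k) ⟩
          false xor (b ∧ false)          ≡⟨ BP.∧-zeroʳ b ⟩
          false                          ∎))
          where open ≡-Reasoning

        Z⊆Below : Z ⊆ Below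
        Z⊆Below {z} z∈Z =
          subst (_∈ Below) (sym z≡a) (a∈Below (Z-below (c z) (subst (λ w → lookup Z w ≡ true) z≡a (∈⇒lookup z∈Z))))
          where
          z≡a : z ≡ a (c z)
          z≡a = ∈A⁻ (symDiffOver-coords⊆A V z∈Z)

      B-maximal : ∀ I → I ⊆ P → Indep v I → B ⊆ I → I ⊆ B
      B-maximal I I⊆P indI B⊆I {y} y∈I with y ∈? B
      ... | yes y∈B = y∈B
      ... | no y∉B = ⊥-elim (indI (V ⊕ Z) W⊆I (⊕-coords-zeroSum V) (y , y∈W))
        where
        open Cancel y (I⊆P y∈I)

        W⊆I : V ⊕ Z ⊆ I
        W⊆I w∈ with x∈p∪q⁻ V Z (⊕⊆∪ V Z w∈)
        ... | inj₂ w∈Z = B⊆I (Below⊆B (Z⊆Below w∈Z))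
        ... | inj₁ w∈V with x∈p∪q⁻ ⁅ y ⁆ _ (⊕⊆∪ ⁅ y ⁆ _ w∈V)
        ...   | inj₁ w∈y = subst (_∈ I) (sym (x∈⁅y⁆⇒x≡y y w∈y)) y∈I
        ...   | inj₂ w∈x = subst (_∈ I) (sym (x∈⁅y⁆⇒x≡y x (scaled-⊆ b ⁅ x ⁆ w∈x))) (B⊆I x∈B)

        y∈W : y ∈ V ⊕ Z
        y∈W = ∈-⊕⁺ V Z (inj₁ (y∈V , λ y∈Z → y∉B (Below⊆B (Z⊆Below y∈Z))))
          where
          y∈V : y ∈ V
          y∈V = ∈-⊕⁺ ⁅ y ⁆ _ (inj₁ (x∈⁅x⁆ y , λ y∈ → y∉B (subst (_∈ B) (sym (x∈⁅y⁆⇒x≡y x (scaled-⊆ b ⁅ x ⁆ y∈))) x∈B)))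

      basis : BasisOf v P B
      basis = B⊆P , B-indep , B-maximal

    minimal : ∀ D → D ⊆ S → MeetsAllBases v P D → S ⊆ D
    minimal D D⊆S meetsD {x} x∈S with meetsD _ (BasisThrough.basis x x∈S)
    ... | z , z∈D∩B with SP.x∈p∩q⁻ D _ z∈D∩B
    ...   | z∈D , z∈B = subst (_∈ D) (BasisThrough.B∩S x x∈S z∈B (D⊆S z∈D)) z∈D

    cut : CutOf v P S
    cut = S⊆P , meets , minimal

  standard : Standard v c
  standard = π , Cut.cut

  module Bottom (0<r : 0 < r) where
    j : Fin r
    j = colourAt (F.fromℕ< 0<r)

    only-j : ∀ {e k} → c e ≡ j → coord e k ≡ true → k ≡ j
    only-j {e} {k} ce≡j coordₖ = position-injective (FP.toℕ-injective (trans (NP.n≤0⇒n≡0 k≤0) (sym j≡0)))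
      where
      j≡0 : F.toℕ (position j) ≡ 0
      j≡0 = trans (cong F.toℕ (position∘colourAt _)) (FP.toℕ-fromℕ< 0<r)
      k≤0 : F.toℕ (position k) ≤ 0
      k≤0 = subst (F.toℕ (position k) ≤_) j≡0 (subst (λ j′ → position k F.≤ position j′) ce≡j (triangular coordₖ))

    coords-bottom : ∀ {e} → c e ≡ j → ∀ y → lookup (coords e) y ≡ lookup ⁅ a j ⁆ y
    coords-bottom {e} ce≡j y = lookup-cong to from
      where
      to : y ∈ coords e → y ∈ ⁅ a j ⁆
      to y∈ = subst (_∈ ⁅ a j ⁆) (sym (trans y≡a (cong a (only-j ce≡j (subst (λ z → Coords e z ≡ true) y≡a (∈⇒lookup y∈))))))
                (x∈⁅x⁆ (a j))
        where
        y≡a : y ≡ a (c y)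
        y≡a = ∈A⁻ (coords⊆A e y∈)
      from : y ∈ ⁅ a j ⁆ → y ∈ coords e
      from y∈ = subst (_∈ coords e) (sym (x∈⁅y⁆⇒x≡y (a j) y∈))
        (lookup⇒∈ (subst (λ k → coord e k ≡ true) ce≡j (coord-own-colour e)))

    parallel : ∀ {e f} → e ∈ ColorClass c j → f ∈ ColorClass c j → e ≢ f → Parallel v e f
    parallel {e} {f} e∈ f∈ e≢f =
      equal-columns⇒parallel v e≢f (singleton-indep e) (singleton-indep f) same-column
      where
      singleton-indep : ∀ x → Indep v ⁅ x ⁆
      singleton-indep x = rainbow⇒indep v c rcf (rainbow-⁅⁆ x)
      same-column : ∀ k → v e k ≡ v f k
      same-column k = begin
        v e k                     ≡⟨ v≡sum-coords e k ⟩
        sumOver v (coords e) k    ≡⟨ sumOver-cong v k (λ y _ → trans (coords-bottom (∈ColorClass⁻ {c = c} e∈) y)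
                                       (sym (coords-bottom (∈ColorClass⁻ {c = c} f∈) y))) ⟩
        sumOver v (coords f) k    ≡⟨ sym (v≡sum-coords f k) ⟩
        v f k                     ∎
        where open ≡-Reasoning

corollary3 : ∀ {m n r} (v : Rep m n) → IsRank v ⊤ r →
    (c : Fin n → Fin r) → Surj c → RainbowCircuitFree v c →
    Standard v c ×
    (0 < r → ∃ λ j → ∀ e f → e ∈ ColorClass c j → f ∈ ColorClass c j → e ≢ f → Parallel v e f)
corollary3 v rank c surjective rcf =
  standard , λ 0<r → Bottom.j 0<r , λ e f → Bottom.parallel 0<r
  where
  open RainbowCircuitFreeColouring v c rcf (proj₂ rank) (λ j → proj₁ (surjective j)) (λ j → proj₂ (surjective j))
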